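{- (a) For any $(v,k,\lambda)$-BIBD, there is at most one positive integer $\ell$ such that the BIBD admits a $0$-ULSE $\ell$-colouring with $\ell<v$. (b) If $\mathcal{D}_1$ is a $(v,k,\lambda_1)$-BIBD admitting a $0$-ULSE $\ell_1$-colouring with $\ell_1<v$ and $\mathcal{D}_2$ is a $(v,k,\lambda_2)$-BIBD admitting a $0$-ULSE $\ell_2$-colouring with $\ell_2<v$, then $\ell_1=\ell_2$.
   Context: For positive integers $v,k,\lambda$ with $2\le k<v$, a $(v,k,\lambda)$-BIBD is a pair $(V,\mathcal{B})$ where $V$ is a set of $v$ points and $\mathcal{B}$ is a collection of $k$-element subsets of $V$ (blocks) such that every pair of distinct points lies in exactly $\lambda$ blocks. An $\ell$-colouring is a surjective map from $V$ onto a set of $\ell$ colours. A $0$-ULSE $\ell$-colouring is an $\ell$-colouring such that $(\ell-1)$ divides $k$ and in every block exactly one colour does not appear, while each of the other $\ell-1$ colours appears exactly $\frac{k}{\ell-1}$ times in that block. It is nontrivial if $\ell<v$. -}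

module Defs where

open import Data.Nat using (ℕ; _≤_; _<_; _∸_; _*_)
open import Data.Nat.Divisibility using (_∣_)
open import Data.Fin using (Fin; _≟_)
open import Data.Fin.Subset using (Subset; ∣_∣)
open import Data.Fin.Subset.Properties using (_∈?_)
open import Data.List using (List; length; filter; allFin)
open import Data.List.Membership.Propositional using () renaming (_∈_ to _∈ˡ_)
open import Data.Product using (Σ; _×_; ∃)
open import Relation.Nullary using (¬_)
open import Relation.Nullary.Decidable using (_×-dec_)
open import Relation.Binary.PropositionalEquality using (_≡_)
open import Function.Definitions using (Surjective)

pairCount : ∀ {v} → List (Subset v) → Fin v → Fin v → ℕ
pairCount blocks x y = length (filter (λ B → (x ∈? B) ×-dec (y ∈? B)) blocks)

-- A (v,k,λ)-BIBD on the point set Fin v; blocks form a multiset (a list).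
record BIBD (v k lam : ℕ) : Set where
  field
    blocks     : List (Subset v)
    two≤k      : 2 ≤ k
    k<v        : k < v
    lam-pos    : 1 ≤ lam
    block-size : ∀ B → B ∈ˡ blocks → ∣ B ∣ ≡ k
    balanced   : ∀ (x y : Fin v) → ¬ (x ≡ y) → pairCount blocks x y ≡ lam
open BIBD public

IsColouring : ∀ {v} (ℓ : ℕ) → (Fin v → Fin ℓ) → Set
IsColouring {v} ℓ c = Surjective _≡_ _≡_ c

colourCount : ∀ {v ℓ} → (Fin v → Fin ℓ) → Subset v → Fin ℓ → ℕ
colourCount {v} c B a = length (filter (λ x → (x ∈? B) ×-dec (c x ≟ a)) (allFin v))

-- 0-ULSE ℓ-colouring of a BIBD D: (ℓ-1) ∣ k, and in every block exactly one
-- colour is absent while every other colour appears exactly k/(ℓ-1) times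
-- (written as count * (ℓ-1) ≡ k, equivalent given (ℓ-1) ∣ k and ℓ-1 ≠ 0).
Is0ULSE : ∀ {v k lam} → BIBD v k lam → (ℓ : ℕ) → (Fin v → Fin ℓ) → Set
Is0ULSE {v} {k} D ℓ c =
  IsColouring ℓ c ×
  (ℓ ∸ 1) ∣ k ×
  (∀ B → B ∈ˡ blocks D →
     ∃ λ (a : Fin ℓ) → colourCount c B a ≡ 0 ×
        (∀ (b : Fin ℓ) → ¬ (b ≡ a) → colourCount c B b * (ℓ ∸ 1) ≡ k))

Admits0ULSE : ∀ {v k lam} → BIBD v k lam → ℕ → Set
Admits0ULSE {v} D ℓ = Σ (Fin v → Fin ℓ) λ c → Is0ULSE D ℓ c

-- Let t = ℓ − 1, r the replication number and N the size of the colour class of a point x.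
-- Count the pairs (B, y) with x, y ∈ B and y coloured like x in two ways. Through the
-- points y it is r + λ (N − 1) by balance. Through the blocks B ∋ x it is r k / t,
-- because the colour of x is present in B and so appears k / t times there. With
-- Fisher's r (k − 1) = λ (v − 1) this makes all colour classes equally large, so
-- ℓ N = v, and eliminating r and N leaves t² (v − k) = k (v − 1): t depends on v
-- and k alone.
module Submission where

open import Defs
open import Data.Nat using (ℕ; _<_)
open import Data.Product using (_×_)
open import Relation.Binary.PropositionalEquality using (_≡_)

open import Level using (Level)
open import Function using (_∘_)
open import Relation.Binary.Definitions using (tri<; tri≈; tri>)
open import Data.Bool using (true; false; if_then_else_)
open import Data.Nat using (zero; suc; _+_; _*_; _≤_; z≤n; s≤s; NonZero; >-nonZero)
open import Data.Nat.Properties hiding (_≟_)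
open import Data.Nat.Divisibility using (0∣⇒≡0)
open import Data.Nat.Tactic.RingSolver using (solve-∀)
open import Data.Fin using (Fin; _≟_; fromℕ<) renaming (zero to fzero; suc to fsuc)
open import Data.Fin.Properties using () renaming (suc-injective to fsuc-injective)
open import Data.Fin.Subset using (Subset; _∈_; ∣_∣; inside; outside)
open import Data.Fin.Subset.Properties using (_∈?_)
open import Data.Vec as Vec using ()
open import Data.List using (List; []; _∷_; length; filter; allFin; tabulate; map)
open import Data.List.Properties using (length-tabulate; map-tabulate; filter-some)
open import Data.List.Membership.Propositional using (lose) renaming (_∈_ to _∈ˡ_)
open import Data.List.Membership.Propositional.Properties using (∈-allFin)
open import Data.List.Relation.Unary.Any using (here; there)
open import Data.Product using (∃; _,_; proj₁; proj₂)
open import Relation.Nullary using (¬_; Dec; yes; no; does; contradiction)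
open import Relation.Nullary.Decidable using (_×-dec_)
open import Relation.Binary.PropositionalEquality
  using (_≢_; refl; sym; trans; cong; cong₂; module ≡-Reasoning)

open ≡-Reasoning

private
  variable
    a b p q : Level
    A : Set a
    A′ : Set b
    P : Set p
    Q : Set q

-- Defined through `does` so that 𝟙 computes under `map′`: 𝟙 (fsuc i ∈? s ∷ p)
-- reduces to 𝟙 (i ∈? p).
𝟙 : Dec P → ℕ
𝟙 P? = if does P? then 1 else 0

𝟙-yes : P → (P? : Dec P) → 𝟙 P? ≡ 1
𝟙-yes _  (yes _) = refl
𝟙-yes p′ (no ¬p) = contradiction p′ ¬p

𝟙-no : ¬ P → (P? : Dec P) → 𝟙 P? ≡ 0
𝟙-no ¬p (yes p′) = contradiction p′ ¬p
𝟙-no _  (no _)   = refl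

𝟙-× : (P? : Dec P) (Q? : Dec Q) → 𝟙 (P? ×-dec Q?) ≡ 𝟙 P? * 𝟙 Q?
𝟙-× (yes _) (yes _) = refl
𝟙-× (yes _) (no _)  = refl
𝟙-× (no _)  (yes _) = refl
𝟙-× (no _)  (no _)  = refl

𝟙-idem : (P? : Dec P) → 𝟙 P? * 𝟙 P? ≡ 𝟙 P?
𝟙-idem (yes _) = refl
𝟙-idem (no _)  = refl

∑ : List A → (A → ℕ) → ℕ
∑ []       f = 0
∑ (x ∷ xs) f = f x + ∑ xs f

∑-syntax : List A → (A → ℕ) → ℕ
∑-syntax = ∑

infix 5 ∑-syntax
syntax ∑-syntax xs (λ x → e) = ∑[ x ∈ xs ] e

∑-cong-∈ : ∀ (xs : List A) {f g : A → ℕ} → (∀ x → x ∈ˡ xs → f x ≡ g x) → ∑ xs f ≡ ∑ xs g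
∑-cong-∈ []       _   = refl
∑-cong-∈ (x ∷ xs) f≗g = cong₂ _+_ (f≗g x (here refl)) (∑-cong-∈ xs (λ y y∈xs → f≗g y (there y∈xs)))

∑-cong : ∀ (xs : List A) {f g : A → ℕ} → (∀ x → f x ≡ g x) → ∑ xs f ≡ ∑ xs g
∑-cong xs f≗g = ∑-cong-∈ xs (λ x _ → f≗g x)

∑-distrib-+ : ∀ (xs : List A) (f g : A → ℕ) → ∑[ x ∈ xs ] (f x + g x) ≡ ∑ xs f + ∑ xs g
∑-distrib-+ []       f g = refl
∑-distrib-+ (x ∷ xs) f g = begin
  f x + g x + (∑[ y ∈ xs ] (f y + g y)) ≡⟨ cong (f x + g x +_) (∑-distrib-+ xs f g) ⟩
  f x + g x + (∑ xs f + ∑ xs g)         ≡⟨ +-assoc-middle (f x) (g x) (∑ xs f) (∑ xs g) ⟩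
  f x + ∑ xs f + (g x + ∑ xs g)         ∎
  where
  +-assoc-middle : ∀ m n o r → m + n + (o + r) ≡ m + o + (n + r)
  +-assoc-middle = solve-∀

*-distribˡ-∑ : ∀ (xs : List A) m (f : A → ℕ) → ∑[ x ∈ xs ] m * f x ≡ m * ∑ xs f
*-distribˡ-∑ []       m f = sym (*-zeroʳ m)
*-distribˡ-∑ (x ∷ xs) m f =
  trans (cong (m * f x +_) (*-distribˡ-∑ xs m f)) (sym (*-distribˡ-+ m (f x) (∑ xs f)))

*-distribʳ-∑ : ∀ (xs : List A) m (f : A → ℕ) → ∑[ x ∈ xs ] f x * m ≡ ∑ xs f * m
*-distribʳ-∑ xs m f = begin
  ∑[ x ∈ xs ] f x * m ≡⟨ ∑-cong xs (λ x → *-comm (f x) m) ⟩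
  ∑[ x ∈ xs ] m * f x ≡⟨ *-distribˡ-∑ xs m f ⟩
  m * ∑ xs f          ≡⟨ *-comm m (∑ xs f) ⟩
  ∑ xs f * m          ∎

∑-const : ∀ (xs : List A) m → ∑[ x ∈ xs ] m ≡ length xs * m
∑-const []       m = refl
∑-const (x ∷ xs) m = cong (m +_) (∑-const xs m)

∑-comm : ∀ (xs : List A) (ys : List A′) (f : A → A′ → ℕ) →
         ∑[ x ∈ xs ] ∑[ y ∈ ys ] f x y ≡ ∑[ y ∈ ys ] ∑[ x ∈ xs ] f x y
∑-comm []       ys f = sym (trans (∑-const ys 0) (*-zeroʳ (length ys)))
∑-comm (x ∷ xs) ys f = begin
  ∑ ys (f x) + (∑[ x′ ∈ xs ] ∑[ y ∈ ys ] f x′ y) ≡⟨ cong (∑ ys (f x) +_) (∑-comm xs ys f) ⟩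
  ∑ ys (f x) + (∑[ y ∈ ys ] ∑[ x′ ∈ xs ] f x′ y) ≡⟨ ∑-distrib-+ ys (f x) _ ⟨
  ∑[ y ∈ ys ] (f x y + (∑[ x′ ∈ xs ] f x′ y))    ∎

∑-map : ∀ (g : A → A′) (xs : List A) (f : A′ → ℕ) → ∑ (map g xs) f ≡ ∑[ x ∈ xs ] f (g x)
∑-map g []       f = refl
∑-map g (x ∷ xs) f = cong (f (g x) +_) (∑-map g xs f)

length-filter≡∑𝟙 : ∀ {P : A → Set p} (P? : ∀ x → Dec (P x)) xs →
                   length (filter P? xs) ≡ ∑[ x ∈ xs ] 𝟙 (P? x)
length-filter≡∑𝟙 P? []       = refl
length-filter≡∑𝟙 P? (x ∷ xs) with does (P? x)
... | true  = cong suc (length-filter≡∑𝟙 P? xs)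
... | false = length-filter≡∑𝟙 P? xs

∑-allFin-suc : ∀ n (f : Fin (suc n) → ℕ) →
               ∑ (allFin (suc n)) f ≡ f fzero + (∑[ i ∈ allFin n ] f (fsuc i))
∑-allFin-suc n f = cong (f fzero +_) (begin
  ∑ (tabulate fsuc) f           ≡⟨ cong (λ is → ∑ is f) (map-tabulate (λ i → i) fsuc) ⟨
  ∑ (map fsuc (allFin n)) f     ≡⟨ ∑-map fsuc (allFin n) f ⟩
  ∑[ i ∈ allFin n ] f (fsuc i)  ∎)

∑-allFin-const : ∀ n m → ∑[ i ∈ allFin n ] m ≡ n * m
∑-allFin-const n m = trans (∑-const (allFin n) m) (cong (_* m) (length-tabulate {n = n} (λ i → i)))

∑-allFin-except : ∀ {n} (f g : Fin n → ℕ) x → (∀ y → y ≢ x → f y ≡ g y) →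
                  ∑ (allFin n) f + g x ≡ ∑ (allFin n) g + f x
∑-allFin-except {suc n} f g fzero f≗g = begin
  ∑ (allFin (suc n)) f + g fzero                     ≡⟨ cong (_+ g fzero) (∑-allFin-suc n f) ⟩
  f fzero + (∑[ i ∈ allFin n ] f (fsuc i)) + g fzero ≡⟨ cong (λ s → f fzero + s + g fzero) tails ⟩
  f fzero + (∑[ i ∈ allFin n ] g (fsuc i)) + g fzero ≡⟨ exchange (f fzero) _ (g fzero) ⟩
  g fzero + (∑[ i ∈ allFin n ] g (fsuc i)) + f fzero ≡⟨ cong (_+ f fzero) (∑-allFin-suc n g) ⟨
  ∑ (allFin (suc n)) g + f fzero                     ∎
  where
  tails : ∑[ i ∈ allFin n ] f (fsuc i) ≡ ∑[ i ∈ allFin n ] g (fsuc i)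
  tails = ∑-cong (allFin n) (λ i → f≗g (fsuc i) λ ())
  exchange : ∀ m s o → m + s + o ≡ o + s + m
  exchange = solve-∀
∑-allFin-except {suc n} f g (fsuc x) f≗g = begin
  ∑ (allFin (suc n)) f + g (fsuc x)
    ≡⟨ cong (_+ g (fsuc x)) (∑-allFin-suc n f) ⟩
  f fzero + (∑[ i ∈ allFin n ] f (fsuc i)) + g (fsuc x)
    ≡⟨ +-assoc (f fzero) _ _ ⟩
  f fzero + ((∑[ i ∈ allFin n ] f (fsuc i)) + g (fsuc x))
    ≡⟨ cong₂ _+_ (f≗g fzero λ ()) tails ⟩
  g fzero + ((∑[ i ∈ allFin n ] g (fsuc i)) + f (fsuc x))
    ≡⟨ +-assoc (g fzero) _ _ ⟨
  g fzero + (∑[ i ∈ allFin n ] g (fsuc i)) + f (fsuc x)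
    ≡⟨ cong (_+ f (fsuc x)) (∑-allFin-suc n g) ⟨
  ∑ (allFin (suc n)) g + f (fsuc x)
    ∎
  where
  tails : (∑[ i ∈ allFin n ] f (fsuc i)) + g (fsuc x) ≡ (∑[ i ∈ allFin n ] g (fsuc i)) + f (fsuc x)
  tails = ∑-allFin-except (f ∘ fsuc) (g ∘ fsuc) x (λ y y≢x → f≗g (fsuc y) (y≢x ∘ fsuc-injective))

∑-allFin-𝟙≟ : ∀ {n} (a : Fin n) → ∑[ j ∈ allFin n ] 𝟙 (a ≟ j) ≡ 1
∑-allFin-𝟙≟ {n} a = begin
  ∑[ j ∈ allFin n ] 𝟙 (a ≟ j)         ≡⟨ +-identityʳ _ ⟨
  (∑[ j ∈ allFin n ] 𝟙 (a ≟ j)) + 0   ≡⟨ ∑-allFin-except _ (λ _ → 0) a (λ j j≢a → 𝟙-no (j≢a ∘ sym) (a ≟ j)) ⟩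
  (∑[ j ∈ allFin n ] 0) + 𝟙 (a ≟ a)   ≡⟨ cong₂ _+_ (trans (∑-allFin-const n 0) (*-zeroʳ n)) (𝟙-yes refl (a ≟ a)) ⟩
  1                                   ∎

∣∣≡∑𝟙∈ : ∀ {n} (p : Subset n) → ∣ p ∣ ≡ ∑[ y ∈ allFin n ] 𝟙 (y ∈? p)
∣∣≡∑𝟙∈ Vec.[]                      = refl
∣∣≡∑𝟙∈ {suc n} p@(inside Vec.∷ q)  = trans (cong suc (∣∣≡∑𝟙∈ q)) (sym (∑-allFin-suc n (λ y → 𝟙 (y ∈? p))))
∣∣≡∑𝟙∈ {suc n} p@(outside Vec.∷ q) = trans (∣∣≡∑𝟙∈ q) (sym (∑-allFin-suc n (λ y → 𝟙 (y ∈? p))))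

m*k+c≡w+m-unique : ∀ {k c w m n} → 2 ≤ k → m * k + c ≡ w + m → n * k + c ≡ w + n → m ≡ n
m*k+c≡w+m-unique {suc (suc k)} {c} {w} {m} {n} (s≤s (s≤s z≤n)) eqₘ eqₙ =
  *-cancelʳ-≡ m n (suc k) (+-cancelʳ-≡ c _ _ (trans (drop eqₘ) (sym (drop eqₙ))))
  where
  drop : ∀ {o} → o * suc (suc k) + c ≡ w + o → o * suc k + c ≡ w
  drop {o} eq = +-cancelˡ-≡ o _ _ (begin
    o + (o * suc k + c)    ≡⟨ +-assoc o _ c ⟨
    o + o * suc k + c      ≡⟨ cong (_+ c) (*-suc o (suc k)) ⟨
    o * suc (suc k) + c    ≡⟨ eq ⟩
    w + o                  ≡⟨ +-comm w o ⟩
    o + w                  ∎)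

replication : ∀ {v} → List (Subset v) → Fin v → ℕ
replication Bs x = ∑[ B ∈ Bs ] 𝟙 (x ∈? B)

pairCount≡∑ : ∀ {v} (Bs : List (Subset v)) x y →
              pairCount Bs x y ≡ ∑[ B ∈ Bs ] 𝟙 (x ∈? B) * 𝟙 (y ∈? B)
pairCount≡∑ Bs x y = trans (length-filter≡∑𝟙 _ Bs) (∑-cong Bs (λ B → 𝟙-× (x ∈? B) (y ∈? B)))

pairCount-diagonal : ∀ {v} (Bs : List (Subset v)) x → pairCount Bs x x ≡ replication Bs x
pairCount-diagonal Bs x = trans (pairCount≡∑ Bs x x) (∑-cong Bs (λ B → 𝟙-idem (x ∈? B)))

∑-blocks≡∑-pairCount : ∀ {v} (Bs : List (Subset v)) x (w : Fin v → ℕ) →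
  ∑[ B ∈ Bs ] 𝟙 (x ∈? B) * (∑[ y ∈ allFin v ] 𝟙 (y ∈? B) * w y)
    ≡ ∑[ y ∈ allFin v ] pairCount Bs x y * w y
∑-blocks≡∑-pairCount {v} Bs x w = begin
  ∑[ B ∈ Bs ] 𝟙 (x ∈? B) * (∑[ y ∈ allFin v ] 𝟙 (y ∈? B) * w y)
    ≡⟨ ∑-cong Bs (λ B → *-distribˡ-∑ (allFin v) (𝟙 (x ∈? B)) _) ⟨
  ∑[ B ∈ Bs ] ∑[ y ∈ allFin v ] 𝟙 (x ∈? B) * (𝟙 (y ∈? B) * w y)
    ≡⟨ ∑-comm Bs (allFin v) _ ⟩
  ∑[ y ∈ allFin v ] ∑[ B ∈ Bs ] 𝟙 (x ∈? B) * (𝟙 (y ∈? B) * w y)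
    ≡⟨ ∑-cong (allFin v) (λ y → ∑-cong Bs (λ B → *-assoc (𝟙 (x ∈? B)) _ (w y))) ⟨
  ∑[ y ∈ allFin v ] ∑[ B ∈ Bs ] 𝟙 (x ∈? B) * 𝟙 (y ∈? B) * w y
    ≡⟨ ∑-cong (allFin v) (λ y → *-distribʳ-∑ Bs (w y) _) ⟩
  ∑[ y ∈ allFin v ] (∑[ B ∈ Bs ] 𝟙 (x ∈? B) * 𝟙 (y ∈? B)) * w y
    ≡⟨ ∑-cong (allFin v) (λ y → cong (_* w y) (pairCount≡∑ Bs x y)) ⟨
  ∑[ y ∈ allFin v ] pairCount Bs x y * w y
    ∎

module _ {v k lam} (D : BIBD v k lam) where

  ∑-blocks-through : ∀ x (w : Fin v → ℕ) →
    (∑[ B ∈ blocks D ] 𝟙 (x ∈? B) * (∑[ y ∈ allFin v ] 𝟙 (y ∈? B) * w y)) + lam * w x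
      ≡ lam * (∑[ y ∈ allFin v ] w y) + replication (blocks D) x * w x
  ∑-blocks-through x w = begin
    (∑[ B ∈ blocks D ] 𝟙 (x ∈? B) * (∑[ y ∈ allFin v ] 𝟙 (y ∈? B) * w y)) + lam * w x
      ≡⟨ cong (_+ lam * w x) (∑-blocks≡∑-pairCount (blocks D) x w) ⟩
    (∑[ y ∈ allFin v ] pairCount (blocks D) x y * w y) + lam * w x
      ≡⟨ ∑-allFin-except _ (λ y → lam * w y) x
           (λ y y≢x → cong (_* w y) (balanced D x y (y≢x ∘ sym))) ⟩
    (∑[ y ∈ allFin v ] lam * w y) + pairCount (blocks D) x x * w x
      ≡⟨ cong₂ _+_ (*-distribˡ-∑ (allFin v) lam w) (cong (_* w x) (pairCount-diagonal (blocks D) x)) ⟩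
    lam * (∑[ y ∈ allFin v ] w y) + replication (blocks D) x * w x
      ∎

  replication-equation : ∀ x → replication (blocks D) x * k + lam ≡ lam * v + replication (blocks D) x
  replication-equation x = begin
    r * k + lam
      ≡⟨ cong₂ _+_ (*-distribʳ-∑ (blocks D) k _) (*-identityʳ lam) ⟨
    (∑[ B ∈ blocks D ] 𝟙 (x ∈? B) * k) + lam * 1
      ≡⟨ cong (_+ lam * 1) (∑-cong-∈ (blocks D) (λ B B∈D → cong (𝟙 (x ∈? B) *_) (block-size′ B B∈D))) ⟩
    (∑[ B ∈ blocks D ] 𝟙 (x ∈? B) * (∑[ y ∈ allFin v ] 𝟙 (y ∈? B) * 1)) + lam * 1
      ≡⟨ ∑-blocks-through x (λ _ → 1) ⟩
    lam * (∑[ y ∈ allFin v ] 1) + r * 1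
      ≡⟨ cong₂ _+_ (cong (lam *_) (trans (∑-allFin-const v 1) (*-identityʳ v))) (*-identityʳ r) ⟩
    lam * v + r
      ∎
    where
    r : ℕ
    r = replication (blocks D) x
    block-size′ : ∀ B → B ∈ˡ blocks D → k ≡ ∑[ y ∈ allFin v ] 𝟙 (y ∈? B) * 1
    block-size′ B B∈D = begin
      k                                   ≡⟨ block-size D B B∈D ⟨
      ∣ B ∣                               ≡⟨ ∣∣≡∑𝟙∈ B ⟩
      ∑[ y ∈ allFin v ] 𝟙 (y ∈? B)        ≡⟨ ∑-cong (allFin v) (λ y → *-identityʳ _) ⟨
      ∑[ y ∈ allFin v ] 𝟙 (y ∈? B) * 1    ∎

  replication-constant : ∀ x y → replication (blocks D) x ≡ replication (blocks D) y
  replication-constant x y =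
    m*k+c≡w+m-unique (two≤k D) (replication-equation x) (replication-equation y)

-- t² (v − k) = k (v − 1) with t = ℓ − 1, both subtractions moved across.
SquareCondition : ℕ → ℕ → ℕ → Set
SquareCondition t v k = t * t * v + k ≡ k * v + t * t * k

-- Eliminates r: (t+1)(k−t)·fisher − (t+1)(k−1)·incidences is λ times the condition;
-- each coefficient is split into its positive and negative parts.
squareCondition-from-counts : ∀ {t N v k r lam} .{{_ : NonZero lam}} → suc t * N ≡ v →
  r * k + lam ≡ lam * v + r → r * k + lam * t ≡ lam * N * t + r * t → SquareCondition t v k
squareCondition-from-counts {t} {N} {_} {k} {r} {lam} refl fisher incidences =
  *-cancelˡ-≡ _ _ lam (+-cancelʳ-≡ combination _ _ (begin
    lam * (t * t * v + k) + combination
      ≡⟨ rearrange t N k r lam ⟩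
    lam * (k * v + t * t * k)
      + suc t * (k * ((r * k + lam) + (lam * N * t + r * t)) + (t * (lam * v + r) + (r * k + lam * t)))
      ≡⟨ cong (λ e → lam * (k * v + t * t * k) + suc t * e)
              (cong₂ (λ e f → k * e + f) (cong₂ _+_ fisher (sym incidences))
                                         (cong₂ _+_ (cong (t *_) (sym fisher)) incidences)) ⟩
    lam * (k * v + t * t * k) + combination
      ∎))
  where
  v combination : ℕ
  v = suc t * N
  combination = suc t * (k * ((lam * v + r) + (r * k + lam * t)) + (t * (r * k + lam) + (lam * N * t + r * t)))
  rearrange : ∀ t N k r lam →
    lam * (t * t * (suc t * N) + k)
      + suc t * (k * ((lam * (suc t * N) + r) + (r * k + lam * t)) + (t * (r * k + lam) + (lam * N * t + r * t)))
    ≡ lam * (k * (suc t * N) + t * t * k)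
      + suc t * (k * ((r * k + lam) + (lam * N * t + r * t)) + (t * (lam * (suc t * N) + r) + (r * k + lam * t)))
  rearrange = solve-∀

m*m≡n*n⇒m≡n : ∀ {m n} → m * m ≡ n * n → m ≡ n
m*m≡n*n⇒m≡n {m} {n} eq with <-cmp m n
... | tri< m<n _ _ = contradiction eq (<⇒≢ (*-mono-< m<n m<n))
... | tri≈ _ m≡n _ = m≡n
... | tri> _ _ n<m = contradiction eq (>⇒≢ (*-mono-< n<m n<m))

squareCondition-unique : ∀ {v k t s} → k < v → SquareCondition t v k → SquareCondition s v k → t ≡ s
squareCondition-unique {k = k} {t} {s} k<v sqₜ sqₛ with o , refl ← m≤n⇒∃[o]m+o≡n k<v =
  m*m≡n*n⇒m≡n (*-cancelʳ-≡ (t * t) (s * s) (suc o) (trans (cleared t sqₜ) (sym (cleared s sqₛ))))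
  where
  cleared : ∀ u → SquareCondition u (suc k + o) k → u * u * suc o ≡ k * (k + o)
  cleared u sq = +-cancelʳ-≡ (u * u * k + k) _ _ (begin
    u * u * suc o + (u * u * k + k)  ≡⟨ expandˡ u k o ⟩
    u * u * (suc k + o) + k          ≡⟨ sq ⟩
    k * (suc k + o) + u * u * k      ≡⟨ expandʳ u k o ⟩
    k * (k + o) + (u * u * k + k)    ∎)
    where
    expandˡ : ∀ u k o → u * u * suc o + (u * u * k + k) ≡ u * u * (suc k + o) + k
    expandˡ = solve-∀
    expandʳ : ∀ u k o → k * (suc k + o) + u * u * k ≡ k * (k + o) + (u * u * k + k)
    expandʳ = solve-∀

colourClassSize : ∀ {v ℓ} → (Fin v → Fin ℓ) → Fin ℓ → ℕ
colourClassSize {v} c a = ∑[ y ∈ allFin v ] 𝟙 (c y ≟ a)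

∑-colourClassSize : ∀ {v ℓ} (c : Fin v → Fin ℓ) → ∑[ a ∈ allFin ℓ ] colourClassSize c a ≡ v
∑-colourClassSize {v} {ℓ} c = begin
  ∑[ a ∈ allFin ℓ ] ∑[ y ∈ allFin v ] 𝟙 (c y ≟ a)  ≡⟨ ∑-comm (allFin ℓ) (allFin v) _ ⟩
  ∑[ y ∈ allFin v ] ∑[ a ∈ allFin ℓ ] 𝟙 (c y ≟ a)  ≡⟨ ∑-cong (allFin v) (λ y → ∑-allFin-𝟙≟ (c y)) ⟩
  ∑[ y ∈ allFin v ] 1                              ≡⟨ ∑-allFin-const v 1 ⟩
  v * 1                                            ≡⟨ *-identityʳ v ⟩
  v                                                ∎

colourCount≡∑ : ∀ {v ℓ} (c : Fin v → Fin ℓ) B a →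
                colourCount c B a ≡ ∑[ y ∈ allFin v ] 𝟙 (y ∈? B) * 𝟙 (c y ≟ a)
colourCount≡∑ {v} c B a =
  trans (length-filter≡∑𝟙 _ (allFin v)) (∑-cong (allFin v) (λ y → 𝟙-× (y ∈? B) (c y ≟ a)))

colourCount-own : ∀ {v ℓ} (c : Fin v → Fin ℓ) {B x} → x ∈ B → 0 < colourCount c B (c x)
colourCount-own c {B} {x} x∈B =
  filter-some (λ y → (y ∈? B) ×-dec (c y ≟ c x)) (lose (∈-allFin x) (x∈B , refl))

module _ {v k lam} (D : BIBD v k lam) {t} .{{_ : NonZero t}}
         (c : Fin v → Fin (suc t)) (ulse : Is0ULSE D (suc t) c) where

  private
    r : Fin v → ℕ
    r = replication (blocks D)

    instance
      lam-nonZero : NonZero lam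
      lam-nonZero = >-nonZero (lam-pos D)

  colourCount-in-block : ∀ {B x} → B ∈ˡ blocks D → x ∈ B → colourCount c B (c x) * t ≡ k
  colourCount-in-block {B} {x} B∈D x∈B with proj₂ (proj₂ ulse) B B∈D
  ... | _ , absent , present = present (c x) λ { refl → <⇒≢ (colourCount-own c x∈B) (sym absent) }

  sameColourIncidences : Fin v → ℕ
  sameColourIncidences x = ∑[ B ∈ blocks D ] 𝟙 (x ∈? B) * colourCount c B (c x)

  sameColourIncidences-byPoints : ∀ x →
    sameColourIncidences x + lam ≡ lam * colourClassSize c (c x) + r x
  sameColourIncidences-byPoints x = begin
    sameColourIncidences x + lam
      ≡⟨ cong₂ _+_ (∑-cong (blocks D) (λ B → cong (𝟙 (x ∈? B) *_) (colourCount≡∑ c B (c x))))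
                   (sym (*-own lam)) ⟩
    (∑[ B ∈ blocks D ] 𝟙 (x ∈? B) * (∑[ y ∈ allFin v ] 𝟙 (y ∈? B) * 𝟙 (c y ≟ c x)))
      + lam * 𝟙 (c x ≟ c x)
      ≡⟨ ∑-blocks-through D x (λ y → 𝟙 (c y ≟ c x)) ⟩
    lam * colourClassSize c (c x) + r x * 𝟙 (c x ≟ c x)
      ≡⟨ cong (lam * colourClassSize c (c x) +_) (*-own (r x)) ⟩
    lam * colourClassSize c (c x) + r x
      ∎
    where
    *-own : ∀ m → m * 𝟙 (c x ≟ c x) ≡ m
    *-own m = trans (cong (m *_) (𝟙-yes refl (c x ≟ c x))) (*-identityʳ m)

  sameColourIncidences-byBlocks : ∀ x → sameColourIncidences x * t ≡ r x * k
  sameColourIncidences-byBlocks x = begin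
    sameColourIncidences x * t                               ≡⟨ *-distribʳ-∑ (blocks D) t _ ⟨
    ∑[ B ∈ blocks D ] 𝟙 (x ∈? B) * colourCount c B (c x) * t ≡⟨ ∑-cong-∈ (blocks D) through ⟩
    ∑[ B ∈ blocks D ] 𝟙 (x ∈? B) * k                         ≡⟨ *-distribʳ-∑ (blocks D) k _ ⟩
    r x * k                                                  ∎
    where
    through : ∀ B → B ∈ˡ blocks D → 𝟙 (x ∈? B) * colourCount c B (c x) * t ≡ 𝟙 (x ∈? B) * k
    through B B∈D with x ∈? B
    ... | no _    = refl
    ... | yes x∈B = begin
      1 * colourCount c B (c x) * t  ≡⟨ cong (_* t) (*-identityˡ (colourCount c B (c x))) ⟩
      colourCount c B (c x) * t      ≡⟨ colourCount-in-block B∈D x∈B ⟩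
      k                              ≡⟨ *-identityˡ k ⟨
      1 * k                          ∎

  colourClassSize-constant : ∀ x y → colourClassSize c (c x) ≡ colourClassSize c (c y)
  colourClassSize-constant x y = *-cancelˡ-≡ _ _ lam (+-cancelʳ-≡ (r x) _ _ (begin
    lam * colourClassSize c (c x) + r x  ≡⟨ sameColourIncidences-byPoints x ⟨
    sameColourIncidences x + lam         ≡⟨ cong (_+ lam) sameIncidences ⟩
    sameColourIncidences y + lam         ≡⟨ sameColourIncidences-byPoints y ⟩
    lam * colourClassSize c (c y) + r y  ≡⟨ cong (lam * colourClassSize c (c y) +_) (replication-constant D y x) ⟩
    lam * colourClassSize c (c y) + r x  ∎))
    where
    sameIncidences : sameColourIncidences x ≡ sameColourIncidences y
    sameIncidences = *-cancelʳ-≡ _ _ t (begin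
      sameColourIncidences x * t  ≡⟨ sameColourIncidences-byBlocks x ⟩
      r x * k                     ≡⟨ cong (_* k) (replication-constant D x y) ⟩
      r y * k                     ≡⟨ sameColourIncidences-byBlocks y ⟨
      sameColourIncidences y * t  ∎)

  colourClassSize-uniform : ∀ x → suc t * colourClassSize c (c x) ≡ v
  colourClassSize-uniform x = begin
    suc t * colourClassSize c (c x)                 ≡⟨ ∑-allFin-const (suc t) _ ⟨
    ∑[ a ∈ allFin (suc t) ] colourClassSize c (c x) ≡⟨ ∑-cong (allFin (suc t)) classOf ⟨
    ∑[ a ∈ allFin (suc t) ] colourClassSize c a     ≡⟨ ∑-colourClassSize c ⟩
    v                                               ∎
    where
    classOf : ∀ a → colourClassSize c a ≡ colourClassSize c (c x)
    classOf a with y , cy≡a ← proj₁ ulse a =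
      trans (cong (colourClassSize c) (sym (cy≡a refl))) (colourClassSize-constant y x)

  squareCondition : SquareCondition t v k
  squareCondition =
    squareCondition-from-counts {N = N} {r = r x₀}
      (colourClassSize-uniform x₀) (replication-equation D x₀) incidences
    where
    x₀ : Fin v
    x₀ = fromℕ< (k<v D)
    N : ℕ
    N = colourClassSize c (c x₀)
    incidences : r x₀ * k + lam * t ≡ lam * N * t + r x₀ * t
    incidences = begin
      r x₀ * k + lam * t                    ≡⟨ cong (_+ lam * t) (sameColourIncidences-byBlocks x₀) ⟨
      sameColourIncidences x₀ * t + lam * t ≡⟨ *-distribʳ-+ t (sameColourIncidences x₀) lam ⟨
      (sameColourIncidences x₀ + lam) * t   ≡⟨ cong (_* t) (sameColourIncidences-byPoints x₀) ⟩
      (lam * N + r x₀) * t                  ≡⟨ *-distribʳ-+ t (lam * N) (r x₀) ⟩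
      lam * N * t + r x₀ * t                ∎

admits0ULSE⇒squareCondition : ∀ {v k lam} (D : BIBD v k lam) {ℓ} → Admits0ULSE D ℓ →
                              ∃ λ t → ℓ ≡ suc t × SquareCondition t v k
admits0ULSE⇒squareCondition D {zero} (c , _) with c (fromℕ< (k<v D))
... | ()
admits0ULSE⇒squareCondition D {suc zero} (_ , _ , 0∣k , _) =
  contradiction (0∣⇒≡0 0∣k) (>⇒≢ (<⇒≤ (two≤k D)))
admits0ULSE⇒squareCondition D {suc (suc t)} (c , ulse) = suc t , refl , squareCondition D c ulse

admits0ULSE-unique : ∀ {v k lam₁ lam₂} (D₁ : BIBD v k lam₁) (D₂ : BIBD v k lam₂) {ℓ₁ ℓ₂} →
                     Admits0ULSE D₁ ℓ₁ → Admits0ULSE D₂ ℓ₂ → ℓ₁ ≡ ℓ₂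
admits0ULSE-unique D₁ D₂ col₁ col₂
  with t₁ , refl , sq₁ ← admits0ULSE⇒squareCondition D₁ col₁
     | t₂ , refl , sq₂ ← admits0ULSE⇒squareCondition D₂ col₂
  = cong suc (squareCondition-unique (k<v D₁) sq₁ sq₂)

theorem3p15 :
    (∀ {v k lam} (D : BIBD v k lam) (ℓ₁ ℓ₂ : ℕ) →
       Admits0ULSE D ℓ₁ → ℓ₁ < v → Admits0ULSE D ℓ₂ → ℓ₂ < v → ℓ₁ ≡ ℓ₂)
    ×
    (∀ {v k lam₁ lam₂} (D₁ : BIBD v k lam₁) (D₂ : BIBD v k lam₂) (ℓ₁ ℓ₂ : ℕ) →
       Admits0ULSE D₁ ℓ₁ → ℓ₁ < v → Admits0ULSE D₂ ℓ₂ → ℓ₂ < v → ℓ₁ ≡ ℓ₂)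
theorem3p15 = (λ D _ _ col₁ _ col₂ _ → admits0ULSE-unique D D col₁ col₂)
            , (λ D₁ D₂ _ _ col₁ _ col₂ _ → admits0ULSE-unique D₁ D₂ col₁ col₂)
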